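{- If $G$ is a minimally 2-connected graph of order $n\geq 4$, then $mvd(G)\leq \left\lfloor \frac{n}{2}\right\rfloor$.
   Context: A graph $G$ is minimally 2-connected if $G$ is 2-connected but $G-e$ is not 2-connected for every edge $e$. For a vertex-coloring of $G$ (adjacent vertices may share colors), a vertex set is monochromatic if all its vertices have the same color; for distinct $x,y$, an $x$-$y$ vertex cut is a set $D\subseteq V(G)\setminus\{x,y\}$ with $x,y$ in different components of $G-D$. A coloring is an MVD-coloring if every two nonadjacent vertices have a monochromatic vertex cut separating them. $mvd(G)$ is the maximum number of colors used by an MVD-coloring of $G$. -}

module Defs where

open import Data.Nat using (ℕ; _≤_; _/_)
open import Data.Fin using (Fin)
open import Data.Fin.Properties using () renaming (_≟_ to _≟ᶠ_)
open import Data.Bool using (Bool; true; false; _∧_; _∨_; not; T)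
open import Data.List using (List; length; map; deduplicate)
open import Data.Product using (Σ; ∃; _×_; _,_)
open import Relation.Nullary using (¬_)
open import Relation.Nullary.Decidable using (⌊_⌋)
open import Relation.Binary.PropositionalEquality using (_≡_)
import Data.Nat.Properties as ℕP
import Data.List as L

Adjacency : ℕ → Set
Adjacency n = Fin n → Fin n → Bool

record Graph (n : ℕ) : Set where
  field
    adj     : Adjacency n
    sym     : ∀ x y → adj x y ≡ adj y x
    irrefl  : ∀ x → adj x x ≡ false
open Graph public

VSet : ℕ → Set
VSet n = Fin n → Bool

-- Reach A D x y : y is reachable from x in the graph (Fin n, A) minus the vertex set D
-- (both x and y must lie outside D).
data Reach {n : ℕ} (A : Adjacency n) (D : VSet n) (x : Fin n) : Fin n → Set where
  here : D x ≡ false → Reach A D x x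
  step : ∀ {y z} → Reach A D x y → A y z ≡ true → D z ≡ false → Reach A D x z

ConnectedMinus : ∀ {n} → Adjacency n → VSet n → Set
ConnectedMinus {n} A D = ∀ (x y : Fin n) → D x ≡ false → D y ≡ false → Reach A D x y

∅ : ∀ {n} → VSet n
∅ _ = false

single : ∀ {n} → Fin n → VSet n
single v u = ⌊ u ≟ᶠ v ⌋

Connected : ∀ {n} → Adjacency n → Set
Connected A = ConnectedMinus A ∅

TwoConnected : ∀ {n} → Adjacency n → Set
TwoConnected {n} A = (3 ≤ n) × Connected A × (∀ (v : Fin n) → ConnectedMinus A (single v))

deleteEdge : ∀ {n} → Adjacency n → Fin n → Fin n → Adjacency n
deleteEdge A u v x y =
  A x y ∧ not ((⌊ x ≟ᶠ u ⌋ ∧ ⌊ y ≟ᶠ v ⌋) ∨ (⌊ x ≟ᶠ v ⌋ ∧ ⌊ y ≟ᶠ u ⌋))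

MinimallyTwoConnected : ∀ {n} → Graph n → Set
MinimallyTwoConnected {n} G =
  TwoConnected (adj G) ×
  (∀ (u v : Fin n) → adj G u v ≡ true → ¬ TwoConnected (deleteEdge (adj G) u v))

-- Vertex colorings (adjacent vertices may share colors); colors are natural numbers.
Coloring : ℕ → Set
Coloring n = Fin n → ℕ

Monochromatic : ∀ {n} → Coloring n → VSet n → Set
Monochromatic {n} c D = Σ ℕ λ k → ∀ (v : Fin n) → D v ≡ true → c v ≡ k

IsVertexCut : ∀ {n} → Graph n → VSet n → Fin n → Fin n → Set
IsVertexCut G D x y = D x ≡ false × D y ≡ false × ¬ Reach (adj G) D x y

IsMVDColoring : ∀ {n} → Graph n → Coloring n → Set
IsMVDColoring {n} G c =
  ∀ (x y : Fin n) → ¬ (x ≡ y) → adj G x y ≡ false →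
    Σ (VSet n) λ D → IsVertexCut G D x y × Monochromatic c D

numColors : ∀ {n} → Coloring n → ℕ
numColors {n} c = length (deduplicate ℕP._≟_ (map c (L.allFin n)))

module Submission where

-- Every vertex v of a minimally 2-connected graph G with at least four vertices has two
-- nonadjacent neighbours a and b: if the neighbourhood of v were a clique, the edge ab between
-- two of its neighbours could be deleted without losing 2-connectivity, since a path through
-- ab can detour through v, or, when v itself is removed, through a third neighbour of v; and
-- if v has no third neighbour, v is a vertex of degree two whose removal leaves a and b joined
-- through any fourth vertex.  In an MVD-colouring, a monochromatic a-b cut D contains v (the
-- path a v b) and, since G - v is connected, some other vertex u; so c u = c v.  Hence no
-- colour class is a singleton, and there are at most n / 2 colours.

open import Defs renaming (sym to adj-sym)
open import Data.Nat using (ℕ; _≤_; _<_; _/_; _*_; _+_; z≤n; s≤s)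
import Data.Nat as ℕ
open import Data.Nat.Properties
  using (≤-refl; ≤-reflexive; ≤-trans; n≤1+n; +-mono-≤; +-suc; *-suc; *-comm; module ≤-Reasoning)
  renaming (_≟_ to _≟ℕ_)
open import Data.Nat.DivMod using (m*n/n≡m; /-monoˡ-≤)
open import Data.Fin using (Fin; zero; suc)
open import Data.Fin.Properties using (any?; all?; pigeonhole; ¬∀⟶∃¬; <⇒≢) renaming (_≟_ to _≟ᶠ_)
open import Data.Vec using ([]; _∷_; lookup)
open import Data.Bool using (true; false; _∧_; _∨_; not)
open import Data.Bool.Properties using (∧-identityʳ; ∧-comm; ∨-comm; ∨-zeroʳ; ¬-not)
  renaming (_≟_ to _≟ᵇ_)
open import Data.List using (List; []; _∷_; length; map; filter; tabulate; allFin; deduplicate)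
open import Data.List.Properties using (length-map; length-tabulate; map-tabulate; filter-reject)
open import Data.List.Membership.Propositional using (_∈_)
open import Data.List.Membership.Propositional.Properties using (∈-map⁻; ∈-deduplicate⁻)
open import Data.List.Relation.Unary.Any using (here; there)
import Data.List.Relation.Unary.All as All
open import Data.List.Relation.Unary.AllPairs using (_∷_)
open import Data.List.Relation.Unary.Unique.Propositional using (Unique)
open import Data.List.Relation.Unary.Unique.DecPropositional.Properties using (deduplicate-!)
open import Data.Product using (∃; ∃₂; _×_; _,_; proj₁; proj₂)
open import Data.Sum using (_⊎_; inj₁; inj₂; [_,_]; swap)
open import Data.Empty using (⊥-elim)
open import Function using (_∘_; id)
open import Relation.Nullary using (¬_; yes; no; contradiction)
open import Relation.Nullary.Decidable
  using (⌊_⌋; _×-dec_; ¬?; dec-true; dec-false; isYes≗does; decidable-stable)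
open import Relation.Binary.Definitions using (DecidableEquality)
open import Relation.Binary.PropositionalEquality
  using (_≡_; _≢_; refl; sym; trans; cong; cong₂; subst; module ≡-Reasoning)

<⇒¬surjective : ∀ {k n} → k < n → (ps : Fin k → Fin n) → ¬ (∀ z → ∃ λ i → ps i ≡ z)
<⇒¬surjective k<n ps onto with pigeonhole k<n (proj₁ ∘ onto)
... | i , j , i<j , same = <⇒≢ i<j (begin
  i                    ≡⟨ proj₂ (onto i) ⟨
  ps (proj₁ (onto i))  ≡⟨ cong ps same ⟩
  ps (proj₁ (onto j))  ≡⟨ proj₂ (onto j) ⟩
  j                    ∎)
  where open ≡-Reasoning

point-outside-image : ∀ {k n} → k < n → (ps : Fin k → Fin n) → ∃ λ z → ∀ i → ps i ≢ z
point-outside-image {k} k<n ps with any? (λ z → all? (λ i → ¬? (ps i ≟ᶠ z)))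
... | yes outside = outside
... | no none = contradiction preimage (<⇒¬surjective k<n ps)
  where
    preimage : ∀ z → ∃ λ i → ps i ≡ z
    preimage z with ¬∀⟶∃¬ k (λ i → ps i ≢ z) (λ i → ¬? (ps i ≟ᶠ z)) (λ missed → none (z , missed))
    ... | i , ¬¬hit = i , decidable-stable (ps i ≟ᶠ z) ¬¬hit

module _ {n : ℕ} where

  _∪_ : VSet n → VSet n → VSet n
  (D ∪ E) u = D u ∨ E u

  _⊆_ : VSet n → VSet n → Set
  D ⊆ E = ∀ u → D u ≡ true → E u ≡ true

  ⊆-∪ˡ : ∀ {D E : VSet n} → D ⊆ (D ∪ E)
  ⊆-∪ˡ {E = E} u u∈D = cong (_∨ E u) u∈D

  ⊆-∪ʳ : ∀ {D E : VSet n} → E ⊆ (D ∪ E)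
  ⊆-∪ʳ {D} u u∈E = trans (cong (D u ∨_) u∈E) (∨-zeroʳ (D u))

  ∉-∈⇒≢ : ∀ {D : VSet n} {u w} → D u ≡ false → D w ≡ true → u ≢ w
  ∉-∈⇒≢ u∉D w∈D refl with trans (sym u∉D) w∈D
  ... | ()

  ⊆-∉ : ∀ {D E : VSet n} {u} → D ⊆ E → E u ≡ false → D u ≡ false
  ⊆-∉ {E = E} {u} D⊆E u∉E = ¬-not (λ u∈D → ∉-∈⇒≢ {D = E} u∉E (D⊆E u u∈D) refl)

  single-self : ∀ v → single {n} v v ≡ true
  single-self v = trans (isYes≗does (v ≟ᶠ v)) (dec-true (v ≟ᶠ v) refl)

  single-≢ : ∀ {u v : Fin n} → u ≢ v → single v u ≡ false
  single-≢ {u} {v} u≢v = trans (isYes≗does (u ≟ᶠ v)) (dec-false (u ≟ᶠ v) u≢v)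

  single-⊆ : ∀ {D : VSet n} {v} → (∀ u → u ≢ v → D u ≡ false) → D ⊆ single v
  single-⊆ {v = v} outside u u∈D with u ≟ᶠ v
  ... | yes _ = refl
  ... | no u≢v = trans (sym (outside u u≢v)) u∈D

module _ {n : ℕ} {A : Adjacency n} {D : VSet n} where

  reach-target∉ : ∀ {x y} → Reach A D x y → D y ≡ false
  reach-target∉ (here x∉D) = x∉D
  reach-target∉ (step _ _ z∉D) = z∉D

  edge : ∀ {y z} → A y z ≡ true → D y ≡ false → D z ≡ false → Reach A D y z
  edge yz y∉D z∉D = step (here y∉D) yz z∉D

  reach-trans : ∀ {x y z} → Reach A D x y → Reach A D y z → Reach A D x z
  reach-trans r (here _) = r
  reach-trans r (step s yz z∉D) = step (reach-trans r s) yz z∉D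

  reach-sym : (∀ x y → A x y ≡ A y x) → ∀ {x y} → Reach A D x y → Reach A D y x
  reach-sym _ (here x∉D) = here x∉D
  reach-sym A-sym (step {y} {z} r yz z∉D) =
    reach-trans (edge (trans (A-sym z y) yz) z∉D (reach-target∉ r)) (reach-sym A-sym r)

  reach⇒neighbour : ∀ {x z} → Reach A D x z → x ≢ z → ∃ λ a → A x a ≡ true × D a ≡ false
  reach⇒neighbour (here _) x≢x = contradiction refl x≢x
  reach⇒neighbour {x} (step {y} {z} r yz z∉D) x≢z with x ≟ᶠ y
  ... | yes refl = z , yz , z∉D
  ... | no x≢y = reach⇒neighbour r x≢y

reach-simulate : ∀ {n} {A B : Adjacency n} {D : VSet n} →
  (∀ {y z} → A y z ≡ true → D y ≡ false → D z ≡ false → Reach B D y z) →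
  ∀ {x y} → Reach A D x y → Reach B D x y
reach-simulate simulate (here x∉D) = here x∉D
reach-simulate simulate (step r yz z∉D) =
  reach-trans (reach-simulate simulate r) (simulate yz (reach-target∉ r) z∉D)

reach-mono : ∀ {n} {A : Adjacency n} {D E : VSet n} → D ⊆ E →
  ∀ {x y} → Reach A E x y → Reach A D x y
reach-mono D⊆E (here x∉E) = here (⊆-∉ D⊆E x∉E)
reach-mono D⊆E (step r yz z∉E) = step (reach-mono D⊆E r) yz (⊆-∉ D⊆E z∉E)

module _ {n : ℕ} (A : Adjacency n) {a b : Fin n} where

  deleteEdge-other : ∀ {y z} → ¬ (y ≡ a × z ≡ b) → ¬ (y ≡ b × z ≡ a) → deleteEdge A a b y z ≡ A y z
  deleteEdge-other {y} {z} ¬ab ¬ba = begin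
    A y z ∧ not ((⌊ y ≟ᶠ a ⌋ ∧ ⌊ z ≟ᶠ b ⌋) ∨ (⌊ y ≟ᶠ b ⌋ ∧ ⌊ z ≟ᶠ a ⌋))
      ≡⟨ cong (λ t → A y z ∧ not t) (cong₂ _∨_ (both-false ¬ab) (both-false ¬ba)) ⟩
    A y z ∧ true
      ≡⟨ ∧-identityʳ (A y z) ⟩
    A y z ∎
    where
      open ≡-Reasoning
      both-false : ∀ {p q r s : Fin n} → ¬ (p ≡ q × r ≡ s) → (⌊ p ≟ᶠ q ⌋ ∧ ⌊ r ≟ᶠ s ⌋) ≡ false
      both-false {p} {q} {r} {s} ¬both =
        trans (cong₂ _∧_ (isYes≗does (p ≟ᶠ q)) (isYes≗does (r ≟ᶠ s)))
              (dec-false ((p ≟ᶠ q) ×-dec (r ≟ᶠ s)) ¬both)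

  deleteEdge-sym : (∀ x y → A x y ≡ A y x) → ∀ x y → deleteEdge A a b x y ≡ deleteEdge A a b y x
  deleteEdge-sym A-sym x y =
    cong₂ (λ s t → s ∧ not t) (A-sym x y)
      (trans (∨-comm (⌊ x ≟ᶠ a ⌋ ∧ ⌊ y ≟ᶠ b ⌋) _)
             (cong₂ _∨_ (∧-comm ⌊ x ≟ᶠ b ⌋ _) (∧-comm ⌊ x ≟ᶠ a ⌋ _)))

  reach-deleteEdge-avoiding : ∀ {D q} → q ≡ a ⊎ q ≡ b → D q ≡ true →
    ∀ {x y} → Reach A D x y → Reach (deleteEdge A a b) D x y
  reach-deleteEdge-avoiding {D} {q} q∈ab q∈D = reach-simulate kept
    where
      kept : ∀ {y z} → A y z ≡ true → D y ≡ false → D z ≡ false → Reach (deleteEdge A a b) D y z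
      kept {y} {z} yz y∉D z∉D = edge (trans (untouched q∈ab) yz) y∉D z∉D
        where
          y≢q : y ≢ q
          y≢q = ∉-∈⇒≢ y∉D q∈D
          z≢q : z ≢ q
          z≢q = ∉-∈⇒≢ z∉D q∈D
          untouched : q ≡ a ⊎ q ≡ b → deleteEdge A a b y z ≡ A y z
          untouched (inj₁ refl) = deleteEdge-other (y≢q ∘ proj₁) (z≢q ∘ proj₂)
          untouched (inj₂ refl) = deleteEdge-other (z≢q ∘ proj₂) (y≢q ∘ proj₁)

module _ {n : ℕ} (G : Graph n) where

  adj⇒≢ : ∀ {x y} → adj G x y ≡ true → x ≢ y
  adj⇒≢ {x} xy refl with trans (sym xy) (irrefl G x)
  ... | ()

  reach-reroute : ∀ {a b p D} → adj G a p ≡ true → adj G p b ≡ true → D p ≡ false →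
    ∀ {x y} → Reach (adj G) D x y → Reach (deleteEdge (adj G) a b) D x y
  reach-reroute {a} {b} {p} {D} ap pb p∉D = reach-simulate simulate
    where
      A′ : Adjacency n
      A′ = deleteEdge (adj G) a b
      p≢a : p ≢ a
      p≢a = adj⇒≢ ap ∘ sym
      p≢b : p ≢ b
      p≢b = adj⇒≢ pb
      detour : D a ≡ false → D b ≡ false → Reach A′ D a b
      detour a∉D b∉D =
        step (edge (trans (deleteEdge-other (adj G) (p≢b ∘ proj₂) (p≢a ∘ proj₂)) ap) a∉D p∉D)
             (trans (deleteEdge-other (adj G) (p≢a ∘ proj₁) (p≢b ∘ proj₁)) pb) b∉D
      simulate : ∀ {y z} → adj G y z ≡ true → D y ≡ false → D z ≡ false → Reach A′ D y z
      simulate {y} {z} yz y∉D z∉D with (y ≟ᶠ a) ×-dec (z ≟ᶠ b) | (y ≟ᶠ b) ×-dec (z ≟ᶠ a)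
      ... | yes (refl , refl) | _ = detour y∉D z∉D
      ... | no _ | yes (refl , refl) =
        reach-sym (deleteEdge-sym (adj G) (adj-sym G)) (detour z∉D y∉D)
      ... | no ¬ab | no ¬ba = edge (trans (deleteEdge-other (adj G) ¬ab ¬ba) yz) y∉D z∉D

  reach-bypass-leaf : ∀ {D v b} → (∀ z → adj G v z ≡ true → D z ≡ false → z ≡ b) →
    ∀ {x y} → x ≢ v → y ≢ v → Reach (adj G) D x y → Reach (adj G) (D ∪ single v) x y
  reach-bypass-leaf {D} {v} {b} leaf {x} x≢v y≢v r =
    [ id , (λ ends-at-v → contradiction (proj₁ ends-at-v) y≢v) ] (bypass r)
    where
      -- A walk can only enter v from b, so cutting it at that b keeps it away from v.
      bypass : ∀ {y} → Reach (adj G) D x y →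
        Reach (adj G) (D ∪ single v) x y ⊎ (y ≡ v × Reach (adj G) (D ∪ single v) x b)
      bypass (here x∉D) = inj₁ (here (cong₂ _∨_ x∉D (single-≢ x≢v)))
      bypass (step {y} {z} r yz z∉D) with bypass r | z ≟ᶠ v
      ... | inj₁ r′ | no z≢v = inj₁ (step r′ yz (cong₂ _∨_ z∉D (single-≢ z≢v)))
      ... | inj₁ r′ | yes refl =
        inj₂ (refl , subst (Reach _ _ x) (leaf y (trans (adj-sym G v y) yz) (reach-target∉ r)) r′)
      ... | inj₂ (refl , r′) | _ = inj₁ (subst (Reach _ _ x) (sym (leaf z yz z∉D)) r′)

  Simplicial : Fin n → Set
  Simplicial v = ∀ {a b} → adj G v a ≡ true → adj G v b ≡ true → a ≢ b → adj G a b ≡ true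

  two-neighbours : TwoConnected (adj G) → ∀ v →
    ∃₂ λ a b → adj G v a ≡ true × adj G v b ≡ true × a ≢ b
  two-neighbours (n≥3 , connected , cut-free) v
    with w , w∉ ← point-outside-image (≤-trans (n≤1+n 2) n≥3) (λ _ → v)
    with a , va , _ ← reach⇒neighbour (connected v w refl refl) (w∉ zero)
    with w′ , w′∉ ← point-outside-image n≥3 (lookup (v ∷ a ∷ []))
    with b , vb , b∉a ← reach⇒neighbour
                          (cut-free a v w′ (single-≢ (adj⇒≢ va)) (single-≢ (w′∉ (suc zero) ∘ sym)))
                          (w′∉ zero)
    = a , b , va , vb , ∉-∈⇒≢ b∉a (single-self a) ∘ sym

  -- The path from x to q in G - p is kept off v, and it avoids the edge ab because it avoids p.
  reach-deleteEdge-off-degree-two : (∀ w → ConnectedMinus (adj G) (single w)) →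
    ∀ {v a b p q} → p ≡ a ⊎ p ≡ b → p ≢ q → adj G v q ≡ true →
    (∀ z → adj G v z ≡ true → z ≡ p ⊎ z ≡ q) →
    ∀ {x} → x ≢ v → x ≢ p → Reach (deleteEdge (adj G) a b) (single v) x q
  reach-deleteEdge-off-degree-two cut-free {v} {a} {b} {p} {q} p∈ab p≢q vq nbrs {x} x≢v x≢p =
    reach-mono (⊆-∪ʳ {D = single p})
      (reach-deleteEdge-avoiding (adj G) p∈ab (⊆-∪ˡ {D = single p} {E = single v} p (single-self p))
        (reach-bypass-leaf leaf x≢v (adj⇒≢ vq ∘ sym)
          (cut-free p x q (single-≢ x≢p) (single-≢ (p≢q ∘ sym)))))
    where
      leaf : ∀ z → adj G v z ≡ true → single p z ≡ false → z ≡ q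
      leaf z vz z∉p = [ (λ z≡p → contradiction z≡p (∉-∈⇒≢ z∉p (single-self p))) , id ] (nbrs z vz)

  degree-two⇒deleteEdge-connectedMinus : (∀ w → ConnectedMinus (adj G) (single w)) → 4 ≤ n →
    ∀ {v a b} → a ≢ b → adj G v a ≡ true → adj G v b ≡ true →
    (∀ z → adj G v z ≡ true → z ≡ a ⊎ z ≡ b) →
    ConnectedMinus (deleteEdge (adj G) a b) (single v)
  degree-two⇒deleteEdge-connectedMinus cut-free n≥4 {v} {a} {b} a≢b va vb nbrs x y x∉ y∉ =
    reach-trans (to-hub x (∉-∈⇒≢ x∉ (single-self v)))
                (reach-sym A′-sym (to-hub y (∉-∈⇒≢ y∉ (single-self v))))
    where
      A′ : Adjacency n
      A′ = deleteEdge (adj G) a b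
      A′-sym : ∀ x y → A′ x y ≡ A′ y x
      A′-sym = deleteEdge-sym (adj G) (adj-sym G)
      to-b : ∀ x → x ≢ v → x ≢ a → Reach A′ (single v) x b
      to-b x = reach-deleteEdge-off-degree-two cut-free (inj₁ refl) a≢b vb nbrs
      to-a : ∀ x → x ≢ v → x ≢ b → Reach A′ (single v) x a
      to-a x = reach-deleteEdge-off-degree-two cut-free (inj₂ refl) (a≢b ∘ sym) va
                 (λ z vz → swap (nbrs z vz))
      hub : ∃ λ z → ∀ i → lookup (v ∷ a ∷ b ∷ []) i ≢ z
      hub = point-outside-image n≥4 (lookup (v ∷ a ∷ b ∷ []))
      z₀ : Fin n
      z₀ = proj₁ hub
      z₀≢v : z₀ ≢ v
      z₀≢v = proj₂ hub zero ∘ sym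
      z₀≢a : z₀ ≢ a
      z₀≢a = proj₂ hub (suc zero) ∘ sym
      z₀≢b : z₀ ≢ b
      z₀≢b = proj₂ hub (suc (suc zero)) ∘ sym
      to-hub : ∀ x → x ≢ v → Reach A′ (single v) x z₀
      to-hub x x≢v with x ≟ᶠ a
      ... | no x≢a = reach-trans (to-b x x≢v x≢a) (reach-sym A′-sym (to-b z₀ z₀≢v z₀≢a))
      ... | yes refl = reach-sym A′-sym (to-a z₀ z₀≢v z₀≢b)

  simplicial⇒deleteEdge-twoConnected : TwoConnected (adj G) → 4 ≤ n →
    ∀ {v a b} → Simplicial v → adj G v a ≡ true → adj G v b ≡ true → a ≢ b →
    TwoConnected (deleteEdge (adj G) a b)
  simplicial⇒deleteEdge-twoConnected (n≥3 , connected , cut-free) n≥4 {v} {a} {b}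
                                     simplicial va vb a≢b =
    n≥3 , (λ x y x∉ y∉ → reach-reroute av vb refl (connected x y x∉ y∉)) , cut-free′
    where
      av : adj G a v ≡ true
      av = trans (adj-sym G a v) va
      cut-free′ : ∀ w → ConnectedMinus (deleteEdge (adj G) a b) (single w)
      cut-free′ w with w ≟ᶠ v
      ... | no w≢v = λ x y x∉ y∉ → reach-reroute av vb (single-≢ (w≢v ∘ sym)) (cut-free w x y x∉ y∉)
      ... | yes refl with any? (λ c → (adj G v c ≟ᵇ true) ×-dec ¬? (c ≟ᶠ a) ×-dec ¬? (c ≟ᶠ b))
      ...   | yes (c , vc , c≢a , c≢b) = λ x y x∉ y∉ →
        reach-reroute (simplicial va vc (c≢a ∘ sym)) (simplicial vc vb c≢b)
                      (single-≢ (adj⇒≢ vc ∘ sym)) (cut-free v x y x∉ y∉)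
      ...   | no no-third = degree-two⇒deleteEdge-connectedMinus cut-free n≥4 a≢b va vb only-a-b
        where
          only-a-b : ∀ z → adj G v z ≡ true → z ≡ a ⊎ z ≡ b
          only-a-b z vz with z ≟ᶠ a | z ≟ᶠ b
          ... | yes z≡a | _ = inj₁ z≡a
          ... | no _ | yes z≡b = inj₂ z≡b
          ... | no z≢a | no z≢b = contradiction (z , vz , z≢a , z≢b) no-third

  minimallyTwoConnected⇒¬simplicial : MinimallyTwoConnected G → 4 ≤ n → ∀ v → ¬ Simplicial v
  minimallyTwoConnected⇒¬simplicial (two-connected , minimal) n≥4 v simplicial
    with a , b , va , vb , a≢b ← two-neighbours two-connected v
    = minimal a b (simplicial va vb a≢b)
        (simplicial⇒deleteEdge-twoConnected two-connected n≥4 simplicial va vb a≢b)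

  nonadjacent-neighbours : MinimallyTwoConnected G → 4 ≤ n → ∀ v →
    ∃₂ λ a b → adj G v a ≡ true × adj G v b ≡ true × a ≢ b × adj G a b ≡ false
  nonadjacent-neighbours minimal n≥4 v with any? (λ a → any? (λ b →
    (adj G v a ≟ᵇ true) ×-dec (adj G v b ≟ᵇ true) ×-dec ¬? (a ≟ᶠ b) ×-dec (adj G a b ≟ᵇ false)))
  ... | yes found = found
  ... | no none = ⊥-elim (minimallyTwoConnected⇒¬simplicial minimal n≥4 v simplicial)
    where
      simplicial : Simplicial v
      simplicial {a} {b} va vb a≢b = ¬-not (λ ab → none (a , b , va , vb , a≢b , ab))

  common-neighbour-∈-cut : ∀ {D x y v} → adj G x v ≡ true → adj G v y ≡ true →
    IsVertexCut G D x y → D v ≡ true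
  common-neighbour-∈-cut xv vy (x∉D , y∉D , separated) =
    ¬-not (λ v∉D → separated (step (edge xv x∉D v∉D) vy y∉D))

  cut-has-vertex-besides : ∀ {D x y} v → ConnectedMinus (adj G) (single v) → IsVertexCut G D x y →
    x ≢ v → y ≢ v → ∃ λ u → u ≢ v × D u ≡ true
  cut-has-vertex-besides {D} {x} {y} v connected (_ , _ , separated) x≢v y≢v
    with any? (λ u → ¬? (u ≟ᶠ v) ×-dec (D u ≟ᵇ true))
  ... | yes found = found
  ... | no none =
    contradiction (reach-mono D⊆v (connected x y (single-≢ x≢v) (single-≢ y≢v))) separated
    where
      D⊆v : D ⊆ single v
      D⊆v = single-⊆ (λ u u≢v → ¬-not (λ u∈D → none (u , u≢v , u∈D)))

  mvd-colour-class-nonsingleton : MinimallyTwoConnected G → 4 ≤ n → ∀ {c} → IsMVDColoring G c →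
    ∀ v → ∃ λ u → u ≢ v × c u ≡ c v
  mvd-colour-class-nonsingleton minimal@((_ , _ , cut-free) , _) n≥4 mvd v
    with a , b , va , vb , a≢b , ab ← nonadjacent-neighbours minimal n≥4 v
    with D , cut , _ , monochromatic ← mvd a b a≢b ab
    with u , u≢v , u∈D ← cut-has-vertex-besides v (cut-free v) cut (adj⇒≢ va ∘ sym) (adj⇒≢ vb ∘ sym)
    = u , u≢v , trans (monochromatic u u∈D) (sym (monochromatic v v∈D))
    where
      v∈D : D v ≡ true
      v∈D = common-neighbour-∈-cut (trans (adj-sym G a v) va) vb cut

module Occurrences {ℓ} {A : Set ℓ} (_≟_ : DecidableEquality A) where

  occurrences : A → List A → ℕ
  occurrences y xs = length (filter (y ≟_) xs)

  without : A → List A → List A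
  without y = filter (¬? ∘ (y ≟_))

  occurrences+length-without : ∀ y xs → occurrences y xs + length (without y xs) ≡ length xs
  occurrences+length-without y [] = refl
  occurrences+length-without y (x ∷ xs) with y ≟ x
  ... | yes _ = cong ℕ.suc (occurrences+length-without y xs)
  ... | no _ = trans (+-suc _ _) (cong ℕ.suc (occurrences+length-without y xs))

  occurrences-without : ∀ {y z} → z ≢ y → ∀ xs → occurrences z (without y xs) ≡ occurrences z xs
  occurrences-without z≢y [] = refl
  occurrences-without {y} {z} z≢y (x ∷ xs) with y ≟ x
  ... | yes refl = trans (occurrences-without z≢y xs) (sym (cong length (filter-reject (z ≟_) z≢y)))
  ... | no _ with z ≟ x
  ...   | yes _ = cong ℕ.suc (occurrences-without z≢y xs)
  ...   | no _ = occurrences-without z≢y xs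

  occurrences-∷ : ∀ y x xs → occurrences y xs ≤ occurrences y (x ∷ xs)
  occurrences-∷ y x xs with y ≟ x
  ... | yes _ = n≤1+n _
  ... | no _ = ≤-refl

  occurrences-here : ∀ y xs → occurrences y (y ∷ xs) ≡ ℕ.suc (occurrences y xs)
  occurrences-here y xs with y ≟ y
  ... | yes _ = refl
  ... | no y≢y = contradiction refl y≢y

  occurrences-tabulate : ∀ {m} (f : Fin m → A) {i y} → f i ≡ y → 1 ≤ occurrences y (tabulate f)
  occurrences-tabulate f {zero} refl
    rewrite occurrences-here (f zero) (tabulate (f ∘ suc)) = s≤s z≤n
  occurrences-tabulate f {suc i} {y} fi≡y =
    ≤-trans (occurrences-tabulate (f ∘ suc) fi≡y) (occurrences-∷ y (f zero) _)

  occurrences-tabulate-twice : ∀ {m} (f : Fin m → A) {i j y} → i ≢ j → f i ≡ y → f j ≡ y →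
    2 ≤ occurrences y (tabulate f)
  occurrences-tabulate-twice f {zero} {zero} i≢j _ _ = contradiction refl i≢j
  occurrences-tabulate-twice f {zero} {suc j} _ refl fj≡y
    rewrite occurrences-here (f zero) (tabulate (f ∘ suc)) =
      s≤s (occurrences-tabulate (f ∘ suc) fj≡y)
  occurrences-tabulate-twice f {suc i} {zero} _ fi≡y refl
    rewrite occurrences-here (f zero) (tabulate (f ∘ suc)) =
      s≤s (occurrences-tabulate (f ∘ suc) fi≡y)
  occurrences-tabulate-twice f {suc i} {suc j} {y} i≢j fi≡y fj≡y =
    ≤-trans (occurrences-tabulate-twice (f ∘ suc) (i≢j ∘ cong suc) fi≡y fj≡y)
            (occurrences-∷ y (f zero) _)

  unique-twice⇒2*length≤ : ∀ ys xs → Unique ys → (∀ {y} → y ∈ ys → 2 ≤ occurrences y xs) →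
    2 * length ys ≤ length xs
  unique-twice⇒2*length≤ [] xs _ _ = z≤n
  unique-twice⇒2*length≤ (y ∷ ys) xs (y∉ys ∷ unique) twice = begin
    2 * ℕ.suc (length ys)                      ≡⟨ *-suc 2 (length ys) ⟩
    2 + 2 * length ys                          ≤⟨ +-mono-≤ (twice (here refl)) rest ⟩
    occurrences y xs + length (without y xs)   ≡⟨ occurrences+length-without y xs ⟩
    length xs                                  ∎
    where
      open ≤-Reasoning
      rest : 2 * length ys ≤ length (without y xs)
      rest = unique-twice⇒2*length≤ ys (without y xs) unique λ {y′} y′∈ys →
        ≤-trans (twice (there y′∈ys))
                (≤-reflexive (sym (occurrences-without (All.lookup y∉ys y′∈ys ∘ sym) xs)))

2*m≤n⇒m≤n/2 : ∀ {m n} → 2 * m ≤ n → m ≤ n / 2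
2*m≤n⇒m≤n/2 {m} {n} 2m≤n = begin
  m          ≡⟨ m*n/n≡m m 2 ⟨
  m * 2 / 2  ≤⟨ /-monoˡ-≤ 2 (subst (_≤ n) (*-comm 2 m) 2m≤n) ⟩
  n / 2      ∎
  where open ≤-Reasoning

numColors≤half : ∀ {n} (c : Coloring n) → (∀ v → ∃ λ u → u ≢ v × c u ≡ c v) → numColors c ≤ n / 2
numColors≤half {n} c partner = 2*m≤n⇒m≤n/2 (begin
  2 * numColors c     ≤⟨ unique-twice⇒2*length≤ colours xs (deduplicate-! _≟ℕ_ xs) twice ⟩
  length xs           ≡⟨ length-map c (allFin n) ⟩
  length (allFin n)   ≡⟨ length-tabulate id ⟩
  n                   ∎)
  where
    open Occurrences _≟ℕ_
    open ≤-Reasoning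
    xs : List ℕ
    xs = map c (allFin n)
    colours : List ℕ
    colours = deduplicate _≟ℕ_ xs
    twice : ∀ {k} → k ∈ colours → 2 ≤ occurrences k xs
    twice k∈colours with v , _ , refl ← ∈-map⁻ c (∈-deduplicate⁻ _≟ℕ_ xs k∈colours)
                    with u , u≢v , cu≡cv ← partner v
      = subst (λ ys → 2 ≤ occurrences (c v) ys) (sym (map-tabulate id c))
              (occurrences-tabulate-twice c (u≢v ∘ sym) refl cu≡cv)

theorem3p5 : ∀ (n : ℕ) (G : Graph n) → 4 ≤ n → MinimallyTwoConnected G →
    ∀ (c : Coloring n) → IsMVDColoring G c → numColors c ≤ n / 2
theorem3p5 n G n≥4 minimal c mvd =
  numColors≤half c (mvd-colour-class-nonsingleton G minimal n≥4 mvd)
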